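{- For every $d \in \mathcal{D}$, the triple $(4d-1, 4d+1, 4d+3)$ is a triplet of $\mathcal{D}$ (the triplet generated by $d$). Moreover, if $d, e \in \mathcal{D}$ with $d \neq e$, then the sets $\{4d-1, 4d+1, 4d+3\}$ and $\{4e-1, 4e+1, 4e+3\}$ are disjoint.
   Context: Let $\mathcal{D}$ (OEIS A036991) be the set of positive integers $m$ such that, in the binary expansion of $m$ written without leading zeros, every suffix contains at least as many digits $1$ as digits $0$. A triplet of $\mathcal{D}$ is a triple $(t-4, t-2, t)$ of integers all belonging to $\mathcal{D}$. -}

module Defs where

open import Data.Nat using (ℕ; zero; suc; _≤_; _<_; _+_; _*_; _∸_)
open import Data.Nat.DivMod using (_/_; _%_)
open import Data.Bool using (Bool; true; false)
open import Data.List using (List; []; _∷_; inits; length; filter)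
open import Data.List.Relation.Unary.All using (All)
open import Data.Product using (_×_)
open import Relation.Binary.PropositionalEquality using (_≡_)

isOne : ℕ → Bool
isOne (suc zero) = true
isOne _ = false

bitsAux : ℕ → ℕ → List Bool
bitsAux zero    m = []
bitsAux (suc f) zero = []
bitsAux (suc f) (suc m) = isOne (suc m % 2) ∷ bitsAux f (suc m / 2)

-- binary expansion of m without leading zeros, least significant digit first
-- (bits 0 = []). Fuel m suffices since m halves at each step.
bits : ℕ → List Bool
bits m = bitsAux m m

count : Bool → List Bool → ℕ
count b [] = 0
count true  (true ∷ xs)  = suc (count true xs)
count false (false ∷ xs) = suc (count false xs)
count true  (false ∷ xs) = count true xs
count false (true ∷ xs)  = count false xs

-- A suffix of the written (MSB-first) expansion is a prefix of the LSB-first list.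
-- m ∈ 𝒟 : m positive and every suffix has at least as many 1s as 0s.
InD : ℕ → Set
InD m = (0 < m) × All (λ s → count false s ≤ count true s) (inits (bits m))

Triplet : ℕ → ℕ → ℕ → Set
Triplet a b c = (b ≡ a + 2) × (c ≡ b + 2) × InD a × InD b × InD c

-- Elements of 𝒟 are odd, as their last digit must be 1. For d = 2k + 1 ∈ 𝒟 the binary
-- expansions of 4d − 1, 4d + 1, 4d + 3 are those of 2k, 2d, d followed by 11, 1, 11
-- respectively. Appending a 1 relaxes the suffix condition by one and appending a 0
-- tightens it by one; k satisfies it with one 0 to spare (d is k followed by 1), so all
-- three numbers lie in 𝒟. They equal 8k + 3, 8k + 5, 8k + 7, so each of them determines
-- k = ⌊x/8⌋ and hence d.
module Submission where

open import Defs
open import Data.Nat using (ℕ; NonZero; zero; suc; _+_; _*_; _∸_; _≤_; _<_; _<?_; z≤n; s≤s)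
open import Data.Nat.Properties
  using (+-suc; ≤-trans; ≤-refl; +-monoˡ-≤; ≤-pred)
open import Data.Nat.DivMod
  using (_/_; _%_; m/n<m; [m+kn]%n≡m%n; m*n%n≡0; m*n/n≡m; +-distrib-/-∣ʳ; m<n⇒m/n≡0)
open import Data.Nat.Divisibility using (n∣m*n)
open import Data.Nat.Tactic.RingSolver using (solve-∀)
open import Data.Bool using (Bool; true; false)
open import Data.List using (List; []; _∷_; inits)
open import Data.List.Relation.Unary.All using (All; []; _∷_)
import Data.List.Relation.Unary.All as All
open import Data.List.Relation.Unary.All.Properties using (map⁺; map⁻)
open import Data.Product using (_×_; _,_; ∃; proj₂)
open import Data.Sum using (_⊎_; inj₁; inj₂)
open import Relation.Binary.PropositionalEquality
  using (_≡_; _≢_; refl; sym; trans; cong; cong₂; subst)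
open import Relation.Nullary using (¬_)
open import Relation.Nullary.Decidable using (from-yes)

private
  variable
    m n o o′ q f g : ℕ
    xs : List Bool

[m+kn]/n≡k : ∀ m k n .{{_ : NonZero n}} → m < n → (m + k * n) / n ≡ k
[m+kn]/n≡k m k n m<n =
  trans (+-distrib-/-∣ʳ m (n∣m*n k)) (cong₂ _+_ (m<n⇒m/n≡0 m<n) (m*n/n≡m k n))

even⊎odd : ∀ n → ∃ λ k → n ≡ k * 2 ⊎ n ≡ 1 + k * 2
even⊎odd zero = 0 , inj₁ refl
even⊎odd (suc n) with even⊎odd n
... | k , inj₁ refl = k , inj₂ refl
... | k , inj₂ refl = suc k , inj₁ refl

bitsAux-fuel-irrelevant : m ≤ f → m ≤ g → bitsAux f m ≡ bitsAux g m
bitsAux-fuel-irrelevant {zero} {zero}  {zero}  _ _ = refl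
bitsAux-fuel-irrelevant {zero} {zero}  {suc g} _ _ = refl
bitsAux-fuel-irrelevant {zero} {suc f} {zero}  _ _ = refl
bitsAux-fuel-irrelevant {zero} {suc f} {suc g} _ _ = refl
bitsAux-fuel-irrelevant {suc m} {suc f} {suc g} (s≤s m≤f) (s≤s m≤g) =
  cong (isOne (suc m % 2) ∷_)
       (bitsAux-fuel-irrelevant (≤-trans half≤m m≤f) (≤-trans half≤m m≤g))
  where
    half≤m : suc m / 2 ≤ m
    half≤m = ≤-pred (m/n<m (suc m) 2 (s≤s (s≤s z≤n)))

bits-suc : ∀ m → bits (suc m) ≡ isOne (suc m % 2) ∷ bits (suc m / 2)
bits-suc m = cong (isOne (suc m % 2) ∷_)
  (bitsAux-fuel-irrelevant (≤-pred (m/n<m (suc m) 2 (s≤s (s≤s z≤n)))) ≤-refl)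

bits-odd : ∀ k → bits (1 + k * 2) ≡ true ∷ bits k
bits-odd k = trans (bits-suc (k * 2))
  (cong₂ _∷_ (cong isOne ([m+kn]%n≡m%n 1 k 2)) (cong bits ([m+kn]/n≡k 1 k 2 (s≤s (s≤s z≤n)))))

bits-even : ∀ k → bits (suc k * 2) ≡ false ∷ bits (suc k)
bits-even k = trans (bits-suc (suc (k * 2)))
  (cong₂ _∷_ (cong isOne (m*n%n≡0 (suc k) 2)) (cong bits (m*n/n≡m (suc k) 2)))

-- Balanced o l: in every prefix of the least-significant-first digit list l, the 0s
-- outnumber the 1s by at most o. Hence InD m is 0 < m × Balanced 0 (bits m).
Balanced : ℕ → List Bool → Set
Balanced o l = All (λ s → count false s ≤ o + count true s) (inits l)

Balanced-mono : o ≤ o′ → Balanced o xs → Balanced o′ xs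
Balanced-mono o≤o′ = All.map (λ p → ≤-trans p (+-monoˡ-≤ _ o≤o′))

true∷-Balanced : Balanced (suc o) xs → Balanced o (true ∷ xs)
true∷-Balanced {o} bal =
  z≤n ∷ map⁺ (All.map (λ {s} p → subst (count false s ≤_) (sym (+-suc o (count true s))) p) bal)

true∷-Balanced⁻ : Balanced o (true ∷ xs) → Balanced (suc o) xs
true∷-Balanced⁻ {o} (_ ∷ bal) =
  All.map (λ {s} p → subst (count false s ≤_) (+-suc o (count true s)) p) (map⁻ bal)

false∷-Balanced : Balanced o xs → Balanced (suc o) (false ∷ xs)
false∷-Balanced bal = z≤n ∷ map⁺ (All.map s≤s bal)

¬false∷-Balanced-0 : ¬ Balanced 0 (false ∷ xs)
¬false∷-Balanced-0 (_ ∷ () ∷ _)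

Balanced-odd : ∀ k → Balanced (suc o) (bits k) → Balanced o (bits (1 + k * 2))
Balanced-odd k bal = subst (Balanced _) (sym (bits-odd k)) (true∷-Balanced bal)

Balanced-odd⁻ : ∀ k → Balanced o (bits (1 + k * 2)) → Balanced (suc o) (bits k)
Balanced-odd⁻ k bal = true∷-Balanced⁻ (subst (Balanced _) (bits-odd k) bal)

Balanced-double : ∀ k → Balanced o (bits k) → Balanced (suc o) (bits (k * 2))
Balanced-double zero    _   = z≤n ∷ []
Balanced-double (suc k) bal = subst (Balanced _) (sym (bits-even k)) (false∷-Balanced bal)

InD-odd : ∀ k → Balanced 1 (bits k) → InD (1 + k * 2)
InD-odd k bal = s≤s z≤n , Balanced-odd k bal

InD⇒odd : InD n → ∃ λ k → n ≡ 1 + k * 2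
InD⇒odd {n} (0<n , bal) with even⊎odd n
... | k , inj₂ n≡1+2k = k , n≡1+2k
... | zero  , inj₁ refl with () ← 0<n
... | suc k , inj₁ refl with () ← ¬false∷-Balanced-0 (subst (Balanced 0) (bits-even k) bal)

-- The solver cannot see through ∸, but 4 * suc m ∸ 1 reduces to m + 3 * suc m.
4*[1+k*2]∸1≡3+k*8 : ∀ k → 4 * (1 + k * 2) ∸ 1 ≡ 3 + k * 8
4*[1+k*2]∸1≡3+k*8 = identity
  where
    identity : ∀ k → k * 2 + 3 * (1 + k * 2) ≡ 3 + k * 8
    identity = solve-∀

4*[1+k*2]+1≡5+k*8 : ∀ k → 4 * (1 + k * 2) + 1 ≡ 5 + k * 8
4*[1+k*2]+1≡5+k*8 = solve-∀

4*[1+k*2]+3≡7+k*8 : ∀ k → 4 * (1 + k * 2) + 3 ≡ 7 + k * 8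
4*[1+k*2]+3≡7+k*8 = solve-∀

Triplet-cong : ∀ {a a′ b b′ c c′} → a ≡ a′ → b ≡ b′ → c ≡ c′ → Triplet a b c → Triplet a′ b′ c′
Triplet-cong refl refl refl t = t

triplet-odd : ∀ k → Balanced 1 (bits k) → Triplet (3 + k * 8) (5 + k * 8) (7 + k * 8)
triplet-odd k bal = gap 3 k , gap 5 k , inD-low , inD-middle , inD-high
  where
    gap : ∀ r k → 2 + r + k * 8 ≡ r + k * 8 + 2
    gap = solve-∀
    low : ∀ k → 3 + k * 8 ≡ 1 + (1 + k * 2 * 2) * 2
    low = solve-∀
    middle : ∀ k → 5 + k * 8 ≡ 1 + (1 + k * 2) * 2 * 2
    middle = solve-∀
    high : ∀ k → 7 + k * 8 ≡ 1 + (1 + (1 + k * 2) * 2) * 2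
    high = solve-∀

    d : ℕ
    d = 1 + k * 2

    bal-d : Balanced 0 (bits d)
    bal-d = Balanced-odd k bal

    inD-low : InD (3 + k * 8)
    inD-low = subst InD (sym (low k))
      (InD-odd (1 + k * 2 * 2) (Balanced-odd (k * 2) (Balanced-double k bal)))

    inD-middle : InD (5 + k * 8)
    inD-middle = subst InD (sym (middle k)) (InD-odd (d * 2) (Balanced-double d bal-d))

    inD-high : InD (7 + k * 8)
    inD-high = subst InD (sym (high k))
      (InD-odd (1 + d * 2) (Balanced-odd d (Balanced-mono z≤n bal-d)))

triplet-generated : InD n → Triplet (4 * n ∸ 1) (4 * n + 1) (4 * n + 3)
triplet-generated inD with InD⇒odd inD
... | k , refl =
  Triplet-cong (sym (4*[1+k*2]∸1≡3+k*8 k)) (sym (4*[1+k*2]+1≡5+k*8 k)) (sym (4*[1+k*2]+3≡7+k*8 k))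
    (triplet-odd k (Balanced-odd⁻ k (proj₂ inD)))

InTriple : ℕ → ℕ → Set
InTriple n x = x ≡ 4 * n ∸ 1 ⊎ x ≡ 4 * n + 1 ⊎ x ≡ 4 * n + 3

InTriple-odd⇒/8 : ∀ k → InTriple (1 + k * 2) m → m / 8 ≡ k
InTriple-odd⇒/8 k (inj₁ refl) =
  trans (cong (_/ 8) (4*[1+k*2]∸1≡3+k*8 k)) ([m+kn]/n≡k 3 k 8 (from-yes (3 <? 8)))
InTriple-odd⇒/8 k (inj₂ (inj₁ refl)) =
  trans (cong (_/ 8) (4*[1+k*2]+1≡5+k*8 k)) ([m+kn]/n≡k 5 k 8 (from-yes (5 <? 8)))
InTriple-odd⇒/8 k (inj₂ (inj₂ refl)) =
  trans (cong (_/ 8) (4*[1+k*2]+3≡7+k*8 k)) ([m+kn]/n≡k 7 k 8 (from-yes (7 <? 8)))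

triples-disjoint : InD m → InD n → m ≢ n → InTriple m q → ¬ InTriple n q
triples-disjoint inDm inDn m≢n q∈m q∈n with InD⇒odd inDm | InD⇒odd inDn
... | k , refl | k′ , refl =
  m≢n (cong (λ k → 1 + k * 2) (trans (sym (InTriple-odd⇒/8 k q∈m)) (InTriple-odd⇒/8 k′ q∈n)))

proposition6 : ((d : ℕ) → InD d → Triplet (4 * d ∸ 1) (4 * d + 1) (4 * d + 3))
    × ((d e : ℕ) → InD d → InD e → ¬ (d ≡ e) →
         (x : ℕ) → (x ≡ 4 * d ∸ 1 ⊎ x ≡ 4 * d + 1 ⊎ x ≡ 4 * d + 3) →
         ¬ (x ≡ 4 * e ∸ 1 ⊎ x ≡ 4 * e + 1 ⊎ x ≡ 4 * e + 3))
proposition6 = (λ _ → triplet-generated) , λ _ _ inDd inDe d≢e _ → triples-disjoint inDd inDe d≢e
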